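{- Consider the subset sum problem with positive integer weights $w_1\ge\dots\ge w_n$ and positive integer capacity $C$ with $\sum_{i=1}^n w_i>C$. Let $t=\min\{k\in N:\sum_{i=n-k+1}^n w_i>C\}$ and $s=t-1$. Then every leaf $0$-tuple and every leaf $1$-tuple of the MBnB tree has at most $t$ components equal to $1$, and the tuple $\tilde\gamma_s=(0,\dots,0,1,\dots,1)$ consisting of $n-s$ zeros followed by $s$ ones is a leaf $1$-tuple.
   Context: Let $N=\{1,\dots,n\}$, $W=\sum_{i\in N}w_i$. A map is a pair $(I,\theta)$ with $I\subseteq N$, $\theta:I\to\{0,1\}$. It satisfies the C0-condition if $\sum_{i\in I}\theta(i)w_i>C$, and the C1-condition if $\sum_{i\in I}(1-\theta(i))w_i\ge W-C$. The MBnB tree: the root is $(\emptyset,\emptyset)$; a node satisfying the C0- or C1-condition is a leaf; otherwise (then $I\ne N$) with $i$ the smallest index of $N\setminus I$ the node has two children $(I\cup\{i\},\theta_0)$, $(I\cup\{i\},\theta_1)$ where $\theta_k$ extends $\theta$ by $\theta_k(i)=k$. For a leaf $(I,\theta)$ satisfying the C0-condition, its leaf $0$-tuple is $z\in\{0,1\}^n$ with $z_i=\theta(i)$ for $i\in I$ and $z_i=0$ for $i\notin I$. For a leaf satisfying the C1-condition, its leaf $1$-tuple is $z$ with $z_i=\theta(i)$ for $i\in I$ and $z_i=1$ for $i\notin I$. -}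

module Defs where

open import Data.Nat using (ℕ; zero; suc; _+_; _∸_; _≤_; _<_; _>_; _≥_)
open import Data.Fin using (Fin; toℕ; _≟_) renaming (zero to fzero; suc to fsuc)
open import Data.Bool using (Bool; true; false; if_then_else_; _∧_; not)
open import Data.Product using (Σ; _×_; _,_)
open import Data.Sum using (_⊎_)
open import Relation.Nullary using (¬_; does)
open import Relation.Binary.PropositionalEquality using (_≡_)

-- Indices of N = {1,…,n} are represented by Fin n (index i ↦ toℕ i + 1).

sumF : ∀ {n} → (Fin n → ℕ) → ℕ
sumF {zero}  f = 0
sumF {suc n} f = f fzero + sumF (λ i → f (fsuc i))

Weights : ℕ → Set
Weights n = Fin n → ℕ

totalW : ∀ {n} → Weights n → ℕ
totalW w = sumF w

NonIncreasing : ∀ {n} → Weights n → Set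
NonIncreasing w = ∀ i j → toℕ i ≤ toℕ j → w j ≤ w i

-- Σ_{i=n-k+1}^{n} w_i  (the k last weights; 0-based: indices i with n-k ≤ i)
tailSum : ∀ {n} → Weights n → ℕ → ℕ
tailSum {n} w k = sumF (λ i → if does (Data.Nat._≤?_ (n ∸ k) (toℕ i)) then w i else 0)

-- A map (I, θ): I ⊆ N as a characteristic function, θ : N → {0,1} of which
-- only the values on I are meaningful (false = 0, true = 1).
record Map (n : ℕ) : Set where
  constructor mkMap
  field
    I : Fin n → Bool
    θ : Fin n → Bool
open Map public

sum1 : ∀ {n} → Weights n → Map n → ℕ
sum1 w m = sumF (λ i → if I m i ∧ θ m i then w i else 0)

sum0 : ∀ {n} → Weights n → Map n → ℕ
sum0 w m = sumF (λ i → if I m i ∧ not (θ m i) then w i else 0)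

C0cond : ∀ {n} → Weights n → ℕ → Map n → Set
C0cond w C m = sum1 w m > C

C1cond : ∀ {n} → Weights n → ℕ → Map n → Set
C1cond w C m = sum0 w m ≥ totalW w ∸ C

SmallestMissing : ∀ {n} → (Fin n → Bool) → Fin n → Set
SmallestMissing I i = I i ≡ false × (∀ j → toℕ j < toℕ i → I j ≡ true)

update : ∀ {n} → (Fin n → Bool) → Fin n → Bool → Fin n → Bool
update f i b j = if does (j ≟ i) then b else f j

data IsNode {n : ℕ} (w : Weights n) (C : ℕ) : Map n → Set where
  root  : IsNode w C (mkMap (λ _ → false) (λ _ → false))
  child : ∀ {m} i (k : Bool) → IsNode w C m →
          ¬ C0cond w C m → ¬ C1cond w C m → SmallestMissing (I m) i →
          IsNode w C (mkMap (update (I m) i true) (update (θ m) i k))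

Tuple : ℕ → Set
Tuple n = Fin n → Bool

IsLeaf0Tuple : ∀ {n} → Weights n → ℕ → Tuple n → Set
IsLeaf0Tuple {n} w C z = Σ (Map n) λ m → IsNode w C m × C0cond w C m ×
  (∀ i → z i ≡ (if I m i then θ m i else false))

IsLeaf1Tuple : ∀ {n} → Weights n → ℕ → Tuple n → Set
IsLeaf1Tuple {n} w C z = Σ (Map n) λ m → IsNode w C m × C1cond w C m ×
  (∀ i → z i ≡ (if I m i then θ m i else true))

ones : ∀ {n} → Tuple n → ℕ
ones z = sumF (λ i → if z i then 1 else 0)

gammaTilde : ∀ n → ℕ → Tuple n
gammaTilde n s i = does (Data.Nat._≤?_ (n ∸ s) (toℕ i))

module Submission where

-- Write sel z w = Σ_{z_i = 1} w_i for the weight selected by a tuple z, and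
-- above d for the indicator of the (0-based) indices i ≥ d; then tailSum w k is
-- sel (above (n ∸ k)) w and γ̃_s is above (n ∸ s), both by definition.
--
-- 1. Because w is non-increasing, a tuple with k ones selects at least the k last
--    weights: tailSum w k ≤ sel z w.  Hence a tuple of weight ≤ C < tailSum w t has
--    fewer than t ones (light⇒few-ones).
-- 2. A map m has a 0-completion (free indices set to 0) and a 1-completion (free
--    indices set to 1).  The C0-condition says the 0-completion is too heavy, and
--    the C1-condition says the 1-completion weighs at most C.
-- 3. The parent of a node violates C0, so its 0-completion has fewer than t ones;
--    branching adds at most one, giving the bound for leaf 0-tuples.  A leaf 1-tuple
--    weighs at most C, so step 1 applies to it directly.
-- 4. Always branching to 0 walks through the maps I = {0,…,d-1}, θ ≡ 0, whose
--    1-completion is above d.  These are inner nodes while Σ_{i ≥ d} w_i > C, and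
--    the first one with Σ_{i ≥ d} w_i ≤ C, namely d = n - (t - 1), yields γ̃_{t-1}.

open import Defs
open import Data.Nat using (ℕ; zero; suc; _+_; _∸_; _≤_; _<_; _>_; z≤n; s≤s; _≤?_)
open import Data.Nat.Properties
  using ( ≤-refl; ≤-trans; ≤-reflexive; <⇒≤; <⇒≱; ≰⇒>; ≮⇒≥; ≤∧≢⇒<; <-≤-trans; <⇒≤pred
        ; +-mono-≤; +-monoˡ-≤; +-monoʳ-≤; +-suc; +-identityʳ; +-cancelˡ-≤; m≤n+m
        ; +-∸-assoc; m∸n≤m; ∸-monoʳ-≤; m+n∸n≡m; m∸n+n≡m; m≤n⇒m≤1+n
        ; pred[m∸n]≡m∸[1+n]; +-commutativeSemigroup; module ≤-Reasoning)
open import Data.Fin using (Fin; toℕ; fromℕ<; _≟_) renaming (zero to fzero; suc to fsuc)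
open import Data.Fin.Properties using (toℕ-fromℕ<; toℕ-injective)
open import Data.Bool using (Bool; true; false; if_then_else_; _∧_; not)
open import Data.Product using (Σ; _×_; _,_)
open import Data.Empty using (⊥-elim)
open import Relation.Nullary using (¬_; does; yes; no)
open import Relation.Nullary.Decidable using (dec-true; dec-false; does-⇔)
open import Function.Bundles using (mk⇔)
open import Relation.Binary.PropositionalEquality
  using (_≡_; _≢_; refl; sym; trans; cong; cong₂; subst)
open import Algebra.Properties.CommutativeSemigroup +-commutativeSemigroup using (interchange)

sumF-cong : ∀ {n} {f g : Fin n → ℕ} → (∀ i → f i ≡ g i) → sumF f ≡ sumF g
sumF-cong {zero}  f≐g = refl
sumF-cong {suc n} f≐g = cong₂ _+_ (f≐g fzero) (sumF-cong (λ i → f≐g (fsuc i)))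

sumF-mono : ∀ {n} {f g : Fin n → ℕ} → (∀ i → f i ≤ g i) → sumF f ≤ sumF g
sumF-mono {zero}  f≤g = z≤n
sumF-mono {suc n} f≤g = +-mono-≤ (f≤g fzero) (sumF-mono (λ i → f≤g (fsuc i)))

sumF-+ : ∀ {n} (f g : Fin n → ℕ) → sumF (λ i → f i + g i) ≡ sumF f + sumF g
sumF-+ {zero}  f g = refl
sumF-+ {suc n} f g =
  trans (cong (f fzero + g fzero +_) (sumF-+ (λ i → f (fsuc i)) (λ i → g (fsuc i))))
        (interchange (f fzero) (g fzero) _ _)

sumF-zero : ∀ {n} → sumF {n} (λ _ → 0) ≡ 0
sumF-zero {zero}  = refl
sumF-zero {suc n} = sumF-zero {n}

sel : ∀ {n} → Tuple n → Weights n → ℕ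
sel z w = sumF (λ i → if z i then w i else 0)

sel-cong : ∀ {n} {z z′ : Tuple n} (w : Weights n) → (∀ i → z i ≡ z′ i) → sel z w ≡ sel z′ w
sel-cong w z≐z′ = sumF-cong (λ i → cong (λ b → if b then w i else 0) (z≐z′ i))

sel-complement : ∀ {n} (z : Tuple n) (w : Weights n) → sel (λ i → not (z i)) w + sel z w ≡ totalW w
sel-complement z w =
  trans (sym (sumF-+ (λ i → if not (z i) then w i else 0) (λ i → if z i then w i else 0)))
        (sumF-cong (λ i → split (z i) (w i)))
  where
  split : ∀ b x → (if not b then x else 0) + (if b then x else 0) ≡ x
  split true  x = refl
  split false x = +-identityʳ x

ones-≤ : ∀ {n} (z : Tuple n) → ones z ≤ n
ones-≤ {zero}  z = z≤n
ones-≤ {suc n} z with z fzero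
... | true  = s≤s (ones-≤ (λ i → z (fsuc i)))
... | false = m≤n⇒m≤1+n (ones-≤ (λ i → z (fsuc i)))

bit≤1 : ∀ b → (if b then 1 else 0) ≤ 1
bit≤1 true  = ≤-refl
bit≤1 false = z≤n

ones-almost-equal : ∀ {n} (i : Fin n) (z z′ : Tuple n) → (∀ j → j ≢ i → z j ≡ z′ j) →
                    ones z ≤ suc (ones z′)
ones-almost-equal fzero z z′ agree =
  ≤-trans (+-mono-≤ (bit≤1 (z fzero)) (≤-reflexive rest-equal)) (s≤s (m≤n+m _ _))
  where
  rest-equal : ones (λ j → z (fsuc j)) ≡ ones (λ j → z′ (fsuc j))
  rest-equal = sel-cong (λ _ → 1) (λ j → agree (fsuc j) (λ ()))
ones-almost-equal (fsuc i) z z′ agree rewrite agree fzero (λ ()) =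
  ≤-trans (+-monoʳ-≤ (if z′ fzero then 1 else 0) rest-bound) (≤-reflexive (+-suc _ _))
  where
  rest-bound : ones (λ j → z (fsuc j)) ≤ suc (ones (λ j → z′ (fsuc j)))
  rest-bound = ones-almost-equal i _ _ (λ j j≢i → agree (fsuc j) (λ { refl → j≢i refl }))

above : ∀ {n} → ℕ → Tuple n
above d i = does (d ≤? toℕ i)

above-shift : ∀ {n} d (w : Weights (suc n)) → sel (above (suc d)) w ≡ sel (above d) (λ i → w (fsuc i))
above-shift d w = sumF-cong (λ i → cong (λ b → if b then w (fsuc i) else 0) (suc≤?suc d (toℕ i)))
  where
  suc≤?suc : ∀ d k → does (suc d ≤? suc k) ≡ does (d ≤? k)
  suc≤?suc zero    k = refl
  suc≤?suc (suc d) k = refl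

above-beyond : ∀ {n d} (w : Weights n) → n ≤ d → sel (above d) w ≡ 0
above-beyond {zero}          w _         = refl
above-beyond {suc n} {suc d} w (s≤s n≤d) = trans (above-shift d w) (above-beyond _ n≤d)

above-antitone : ∀ {n} (w : Weights n) {d d′} → d ≤ d′ → sel (above d′) w ≤ sel (above d) w
above-antitone w {d} {d′} d≤d′ = sumF-mono pointwise
  where
  pointwise : ∀ i → (if does (d′ ≤? toℕ i) then w i else 0) ≤ (if does (d ≤? toℕ i) then w i else 0)
  pointwise i with d′ ≤? toℕ i
  ... | no  d′≰i rewrite dec-false (d′ ≤? toℕ i) d′≰i = z≤n
  ... | yes d′≤i rewrite dec-true (d′ ≤? toℕ i) d′≤i
                       | dec-true (d ≤? toℕ i) (≤-trans d≤d′ d′≤i) = ≤-refl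

above-step : ∀ {n} (w : Weights n) b → (∀ i → w i ≤ b) →
             ∀ d → sel (above d) w ≤ b + sel (above (suc d)) w
above-step {zero}  w b w≤b d       = z≤n
above-step {suc n} w b w≤b zero    = +-monoˡ-≤ _ (w≤b fzero)
above-step {suc n} w b w≤b (suc d) = begin
  sel (above (suc d)) w        ≡⟨ above-shift d w ⟩
  sel (above d) w′             ≤⟨ above-step w′ b (λ i → w≤b (fsuc i)) d ⟩
  b + sel (above (suc d)) w′   ≡⟨ cong (b +_) (sym (above-shift (suc d) w)) ⟩
  b + sel (above (suc (suc d))) w ∎
  where
  open ≤-Reasoning
  w′ : Weights n
  w′ i = w (fsuc i)

tail-≤-sel : ∀ {n} (w : Weights n) → NonIncreasing w → (z : Tuple n) →
             sel (above (n ∸ ones z)) w ≤ sel z w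
tail-≤-sel {zero}  w ni z = z≤n
tail-≤-sel {suc n} w ni z = with-head (z fzero) (tail-≤-sel w′ ni′ z′)
  where
  open ≤-Reasoning
  w′ : Weights n
  w′ i = w (fsuc i)
  z′ : Tuple n
  z′ i = z (fsuc i)
  ni′ : NonIncreasing w′
  ni′ i j i≤j = ni (fsuc i) (fsuc j) (s≤s i≤j)
  k : ℕ
  k = ones z′
  -- The head item either is unselected (the suffix just moves past it) or is
  -- selected and outweighs the one extra suffix item.
  with-head : ∀ b → sel (above (n ∸ k)) w′ ≤ sel z′ w′ →
              sel (above (suc n ∸ ((if b then 1 else 0) + k))) w ≤ (if b then w fzero else 0) + sel z′ w′
  with-head false ih = begin
    sel (above (suc n ∸ k)) w   ≡⟨ cong (λ d → sel (above d) w) (+-∸-assoc 1 (ones-≤ z′)) ⟩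
    sel (above (suc (n ∸ k))) w ≡⟨ above-shift (n ∸ k) w ⟩
    sel (above (n ∸ k)) w′      ≤⟨ ih ⟩
    sel z′ w′                   ∎
  with-head true ih = begin
    sel (above (n ∸ k)) w                 ≤⟨ above-step w (w fzero) (λ i → ni fzero i z≤n) (n ∸ k) ⟩
    w fzero + sel (above (suc (n ∸ k))) w ≡⟨ cong (w fzero +_) (above-shift (n ∸ k) w) ⟩
    w fzero + sel (above (n ∸ k)) w′      ≤⟨ +-monoʳ-≤ (w fzero) ih ⟩
    w fzero + sel z′ w′                   ∎

light⇒few-ones : ∀ {n} (w : Weights n) → NonIncreasing w → ∀ {C t} (z : Tuple n) →
                 sel z w ≤ C → C < tailSum w t → ones z < t
light⇒few-ones {n} w ni {C} {t} z light heavy with t ≤? ones z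
... | no  t≰ones = ≰⇒> t≰ones
... | yes t≤ones = ⊥-elim (<⇒≱ heavy (begin
  tailSum w t                ≤⟨ above-antitone w (∸-monoʳ-≤ n t≤ones) ⟩
  sel (above (n ∸ ones z)) w ≤⟨ tail-≤-sel w ni z ⟩
  sel z w                    ≤⟨ light ⟩
  C                          ∎))
  where open ≤-Reasoning

zeroCompletion : ∀ {n} → Map n → Tuple n
zeroCompletion m i = if I m i then θ m i else false

oneCompletion : ∀ {n} → Map n → Tuple n
oneCompletion m i = if I m i then θ m i else true

sum1-as-sel : ∀ {n} (w : Weights n) (m : Map n) → sum1 w m ≡ sel (zeroCompletion m) w
sum1-as-sel w m = sel-cong w (λ i → ∧-as-if (I m i) (θ m i))
  where
  ∧-as-if : ∀ a b → a ∧ b ≡ (if a then b else false)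
  ∧-as-if true  b = refl
  ∧-as-if false b = refl

-- The fixed zeros are exactly the items outside the 1-completion.
sum0-complement : ∀ {n} (w : Weights n) (m : Map n) → sum0 w m + sel (oneCompletion m) w ≡ totalW w
sum0-complement w m =
  trans (cong (_+ sel (oneCompletion m) w) (sel-cong w (λ i → fixed-zero (I m i) (θ m i))))
        (sel-complement (oneCompletion m) w)
  where
  fixed-zero : ∀ a b → a ∧ not b ≡ not (if a then b else true)
  fixed-zero true  b = refl
  fixed-zero false b = refl

C1⇒light : ∀ {n} (w : Weights n) {C} (m : Map n) → C ≤ totalW w → C1cond w C m →
           sel (oneCompletion m) w ≤ C
C1⇒light w {C} m C≤W c1 = +-cancelˡ-≤ (sum0 w m) _ _ (begin
  sum0 w m + sel (oneCompletion m) w ≡⟨ sum0-complement w m ⟩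
  totalW w                           ≡⟨ sym (m∸n+n≡m C≤W) ⟩
  totalW w ∸ C + C                   ≤⟨ +-monoˡ-≤ C c1 ⟩
  sum0 w m + C                       ∎)
  where open ≤-Reasoning

light⇒C1 : ∀ {n} (w : Weights n) {C} (m : Map n) → sel (oneCompletion m) w ≤ C → C1cond w C m
light⇒C1 w {C} m light = begin
  totalW w ∸ C                            ≤⟨ ∸-monoʳ-≤ (totalW w) light ⟩
  totalW w ∸ x                            ≡⟨ cong (_∸ x) (sym (sum0-complement w m)) ⟩
  sum0 w m + x ∸ x                        ≡⟨ m+n∸n≡m (sum0 w m) x ⟩
  sum0 w m                                ∎
  where
  open ≤-Reasoning
  x : ℕ
  x = sel (oneCompletion m) w

update-other : ∀ {n} (f : Fin n → Bool) {i} b {j} → j ≢ i → update f i b j ≡ f j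
update-other f {i} b {j} j≢i = cong (λ c → if c then b else f j) (dec-false (j ≟ i) j≢i)

-- Every node's 0-completion has at most t ones: its parent's has fewer than t,
-- since the parent violates C0, and branching changes a single coordinate.
node-ones-≤ : ∀ {n} {w : Weights n} {C t} → NonIncreasing w → C < tailSum w t →
              ∀ {m} → IsNode w C m → ones (zeroCompletion m) ≤ t
node-ones-≤ {n} ni heavy root = subst (_≤ _) (sym (sumF-zero {n})) z≤n
node-ones-≤ {w = w} {C} ni heavy (child {m} i k _ notC0 _ _) =
  ≤-trans (ones-almost-equal i _ (zeroCompletion m) agree)
          (light⇒few-ones w ni (zeroCompletion m) light heavy)
  where
  agree : ∀ j → j ≢ i →
          zeroCompletion (mkMap (update (I m) i true) (update (θ m) i k)) j ≡ zeroCompletion m j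
  agree j j≢i = cong₂ (λ a b → if a then b else false)
                      (update-other (I m) true j≢i) (update-other (θ m) k j≢i)
  light : sel (zeroCompletion m) w ≤ C
  light = subst (_≤ C) (sum1-as-sel w m) (≮⇒≥ notC0)

leaf0-ones-≤ : ∀ {n} {w : Weights n} {C t} → NonIncreasing w → C < tailSum w t →
               (z : Tuple n) → IsLeaf0Tuple w C z → ones z ≤ t
leaf0-ones-≤ {t = t} ni heavy z (m , node , _ , z≐) =
  subst (_≤ t) (sym (sel-cong (λ _ → 1) z≐)) (node-ones-≤ ni heavy node)

-- A leaf 1-tuple is the 1-completion of a node satisfying C1, hence weighs at most C.
leaf1-ones-≤ : ∀ {n} {w : Weights n} {C t} → NonIncreasing w → C ≤ totalW w → C < tailSum w t →
               (z : Tuple n) → IsLeaf1Tuple w C z → ones z ≤ t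
leaf1-ones-≤ {w = w} {C} ni C≤W heavy z (m , _ , c1 , z≐) =
  <⇒≤ (light⇒few-ones w ni z light heavy)
  where
  light : sel z w ≤ C
  light = subst (_≤ C) (sym (sel-cong w z≐)) (C1⇒light w m C≤W c1)

-- The all-zero path: maps with I = {0,…,d-1} and θ ≡ 0, characterised pointwise
-- because maps are functions and only pointwise equality is available.
IsZeroPrefix : ∀ {n} → ℕ → Map n → Set
IsZeroPrefix d m = (∀ i → I m i ≡ not (above d i)) × (∀ i → θ m i ≡ false)

zeroPrefix-zeroCompletion : ∀ {n d} {m : Map n} → IsZeroPrefix d m → ∀ i → zeroCompletion m i ≡ false
zeroPrefix-zeroCompletion {m = m} (_ , θ≐) i rewrite θ≐ i with I m i
... | true  = refl
... | false = refl

zeroPrefix-oneCompletion : ∀ {n d} {m : Map n} → IsZeroPrefix d m → ∀ i → oneCompletion m i ≡ above d i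
zeroPrefix-oneCompletion {d = d} (I≐ , θ≐) i rewrite I≐ i | θ≐ i with above d i
... | true  = refl
... | false = refl

above-skip : ∀ {n} d (j : Fin n) → toℕ j ≢ d → does (d ≤? toℕ j) ≡ does (suc d ≤? toℕ j)
above-skip d j j≢d = does-⇔ (mk⇔ d≤j⇒d<j <⇒≤) (d ≤? toℕ j) (suc d ≤? toℕ j)
  where
  d≤j⇒d<j : d ≤ toℕ j → d < toℕ j
  d≤j⇒d<j d≤j = ≤∧≢⇒< d≤j (λ d≡j → j≢d (sym d≡j))

zeroPrefix-step : ∀ {n} {w : Weights n} {C d} {m : Map n} → IsNode w C m → IsZeroPrefix d m →
                  ¬ C0cond w C m → ¬ C1cond w C m → d < n →
                  Σ (Map n) λ m′ → IsNode w C m′ × IsZeroPrefix (suc d) m′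
zeroPrefix-step {d = d} {m} node (I≐ , θ≐) notC0 notC1 d<n =
  _ , child i false node notC0 notC1 smallest , I′≐ , θ′≐
  where
  i : Fin _
  i = fromℕ< d<n
  i≡d : toℕ i ≡ d
  i≡d = toℕ-fromℕ< d<n
  smallest : SmallestMissing (I m) i
  smallest = trans (I≐ i) (cong not (dec-true (d ≤? toℕ i) (≤-reflexive (sym i≡d))))
           , λ j j<i → trans (I≐ j)
                             (cong not (dec-false (d ≤? toℕ j) (<⇒≱ (subst (toℕ j <_) i≡d j<i))))
  I′≐ : ∀ j → update (I m) i true j ≡ not (above (suc d) j)
  I′≐ j with j ≟ i
  ... | yes refl = sym (cong not (dec-false (suc d ≤? toℕ i) (λ d<i → <⇒≱ d<i (≤-reflexive i≡d))))
  ... | no  j≢i  =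
    trans (I≐ j) (cong not (above-skip d j (λ j≡d → j≢i (toℕ-injective (trans j≡d (sym i≡d))))))
  θ′≐ : ∀ j → update (θ m) i false j ≡ false
  θ′≐ j with does (j ≟ i)
  ... | true  = refl
  ... | false = θ≐ j

zeroPrefix-node : ∀ {n} (w : Weights n) {C} → C ≤ totalW w → ∀ d → d ≤ n →
                  (∀ d′ → d′ < d → C < sel (above d′) w) →
                  Σ (Map n) λ m → IsNode w C m × IsZeroPrefix d m
zeroPrefix-node w C≤W zero _ _ = mkMap (λ _ → false) (λ _ → false) , root , (λ _ → refl) , (λ _ → refl)
zeroPrefix-node {n} w {C} C≤W (suc d) d<n heavy
  with zeroPrefix-node w C≤W d (<⇒≤ d<n) (λ d′ d′<d → heavy d′ (m≤n⇒m≤1+n d′<d))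
... | m , node , prefix = zeroPrefix-step node prefix notC0 notC1 d<n
  where
  notC0 : ¬ C0cond w C m
  notC0 c0 = <⇒≱ c0 (subst (_≤ C) (sym sum1≡0) z≤n)
    where
    sum1≡0 : sum1 w m ≡ 0
    sum1≡0 = trans (sum1-as-sel w m)
                   (trans (sel-cong w (zeroPrefix-zeroCompletion {d = d} prefix)) (sumF-zero {n}))
  notC1 : ¬ C1cond w C m
  notC1 c1 = <⇒≱ (heavy d ≤-refl)
                 (subst (_≤ C) (sel-cong w (zeroPrefix-oneCompletion {d = d} prefix))
                               (C1⇒light w m C≤W c1))

gammaTilde-leaf : ∀ {n} (w : Weights n) {C} → C ≤ totalW w → ∀ s →
                  C < tailSum w (suc s) → tailSum w s ≤ C → IsLeaf1Tuple w C (gammaTilde n s)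
gammaTilde-leaf {n} w {C} C≤W s heavy light with zeroPrefix-node w C≤W (n ∸ s) (m∸n≤m n s) heavier
  where
  heavier : ∀ d′ → d′ < n ∸ s → C < sel (above d′) w
  heavier d′ d′<d =
    <-≤-trans heavy (above-antitone w (subst (d′ ≤_) (pred[m∸n]≡m∸[1+n] n s) (<⇒≤pred d′<d)))
... | m , node , prefix = m , node , c1 , λ i → sym (zeroPrefix-oneCompletion {d = n ∸ s} prefix i)
  where
  c1 : C1cond w C m
  c1 = light⇒C1 w m
         (subst (_≤ C) (sym (sel-cong w (zeroPrefix-oneCompletion {d = n ∸ s} prefix))) light)

-- The last t - 1 weights fit into C: by minimality of t, or trivially when t = 1.
pred-tail-light : ∀ {n} (w : Weights n) {C} s → (∀ k → 1 ≤ k → k < suc s → tailSum w k ≤ C) →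
                  tailSum w s ≤ C
pred-tail-light {n} w {C} zero    _     = subst (_≤ C) (sym (above-beyond w (≤-refl {n}))) z≤n
pred-tail-light         w (suc s) below = below (suc s) (s≤s z≤n) ≤-refl

proposition13 : (n : ℕ) (w : Weights n) (C : ℕ) →
    (∀ i → 0 < w i) → NonIncreasing w → 0 < C → totalW w > C →
    (t : ℕ) → 1 ≤ t → t ≤ n → tailSum w t > C →
    (∀ k → 1 ≤ k → k < t → tailSum w k ≤ C) →
    ((z : Tuple n) → IsLeaf0Tuple w C z → ones z ≤ t) ×
    ((z : Tuple n) → IsLeaf1Tuple w C z → ones z ≤ t) ×
    IsLeaf1Tuple w C (gammaTilde n (t ∸ 1))
proposition13 n w C _ _  _ _   zero    ()
proposition13 n w C _ ni _ W>C (suc s) _ _ heavy below =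
    leaf0-ones-≤ ni heavy
  , leaf1-ones-≤ ni (<⇒≤ W>C) heavy
  , gammaTilde-leaf w (<⇒≤ W>C) s heavy (pred-tail-light w s below)
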